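{- Let $n$ be a positive integer, and let $f(n,2)$ denote the smallest possible number of sets in a $2$-hyperseparating set system on an $n$-element underlying set. Then $$f(n,2)=\begin{cases}\min\{m:\binom{m}{2}\ge n\} & \text{if } n\ge 10,\\ \lceil n/2\rceil & \text{if } n\le 10.\end{cases}$$
   Context: A set system on an underlying set $V$ is a family $\mathcal{F}$ of subsets of $V$. For a positive integer $k$, the set system $\mathcal{F}\subseteq 2^V$ is called $k$-hyperseparating if for every element $v\in V$ there exist sets $A_1,\dots,A_k\in\mathcal{F}$ and an index $i\in\{0,1,\dots,k\}$ such that $v\in A_1,\dots,A_i$ and $v\notin A_{i+1},\dots,A_k$, and no other element $u\in V$, $u\neq v$, satisfies this same property (i.e., there is no $u\neq v$ with $u\in A_1,\dots,A_i$ and $u\notin A_{i+1},\dots,A_k$). -}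

module Defs where

open import Data.Nat using (ℕ; suc; _≤_; _<_)
open import Data.Nat.Combinatorics using (_C_)
open import Data.Fin using (Fin; toℕ)
open import Data.Fin.Subset using (Subset; _∈_; _∉_)
open import Data.Product using (Σ; ∃; _×_)
open import Relation.Binary.PropositionalEquality using (_≡_)
open import Function.Definitions using (Injective)
open import Relation.Nullary using (¬_)

-- A set system on the underlying set V = Fin n with m members:
-- the members are indexed by Fin m; they are required to be pairwise distinct
-- (a family of subsets), so the number of sets in the system is exactly m.
record SetSystem (n m : ℕ) : Set where
  field
    member   : Fin m → Subset n
    distinct : Injective _≡_ _≡_ member
open SetSystem public

-- Element u matches the pattern (A_1,…,A_k ; i): u ∈ A_j for j ≤ i and u ∉ A_j for j > i
-- (indices j = 1..k, represented as Fin k with j ↦ toℕ j + 1).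
Matches : ∀ {n m k} → SetSystem n m → (Fin k → Fin m) → Fin (suc k) → Fin n → Set
Matches {k = k} F A i u =
  (j : Fin k) → (suc (toℕ j) Data.Nat.≤ toℕ i → u ∈ member F (A j))
              × (toℕ i Data.Nat.< suc (toℕ j) → u ∉ member F (A j))

Hyperseparating : ∀ {n m} → ℕ → SetSystem n m → Set
Hyperseparating {n} {m} k F =
  (v : Fin n) → Σ (Fin k → Fin m) λ A → Σ (Fin (suc k)) λ i →
    Matches F A i v × ((u : Fin n) → ¬ (u ≡ v) → ¬ Matches F A i u)

IsMinHypSepSize : ℕ → ℕ → ℕ → Set
IsMinHypSepSize n k t =
  Σ (SetSystem n t) (Hyperseparating k) ×
  ((m : ℕ) → (F : SetSystem n m) → Hyperseparating k F → t Data.Nat.≤ m)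

IsMinBinom2 : ℕ → ℕ → Set
IsMinBinom2 n t = (n Data.Nat.≤ t C 2) × ((m : ℕ) → m Data.Nat.< t → m C 2 Data.Nat.< n)

-- Read a set system with m sets on n elements as its n × m Boolean incidence matrix; the literal
-- (a , γ) holds at u when [u ∈ A_a] = γ.  The system is 2-hyperseparating exactly when every
-- element is the only one satisfying some pair of literals, its key.
--
-- Lower bound n ≤ max (2m, C(m,2)), by induction on m.  If some literal holds at no more than
-- two elements, delete them together with the literal's column, on which the remaining elements
-- are constant.  Otherwise every key uses two different columns, and two elements whose keys
-- use the same columns p, q have complementary keys; every other element then has column q equal
-- to column p xor a constant, so column q and the two elements can be deleted.  If no two keys
-- use the same columns, n ≤ C(m,2).
--
-- For n ≥ 10 and t = min {m : C(m,2) ≥ n}, the elements are the first n pairs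
-- from {0, …, t−1} in colex order, among them all pairs from {0, …, t−2}, and S_a consists of
-- the pairs containing a; the pair {c, d} is cut out by S_c and S_d.  For m = ⌈n/2⌉ take the
-- half-arcs S_a = {e : a < e ≤ a + m}, a < m.  With their complements they are the 2m arcs
-- A_k = (k, k + m] of the cycle ℤ/2m, and A_{e−1} ∖ A_e = {e}.
module Submission where

open import Defs
open import Level using (0ℓ)
open import Data.Nat
  using (ℕ; zero; suc; _+_; _*_; _⊔_; _≤_; _<_; z≤n; s≤s; s≤s⁻¹; z<s; _≤′_; ≤′-refl; ≤′-step;
         ⌈_/2⌉; ⌊_/2⌋; _≤?_; _<?_)
import Data.Nat as ℕ
open import Data.Nat.Properties hiding (_≟_)
open import Data.Nat.Combinatorics using (_C_; nC1≡n; nCk+nC[k+1]≡[n+1]C[k+1])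
open import Data.Bool using (Bool; true; false; not; _xor_)
import Data.Bool.Properties as Bool
open import Data.Fin using (Fin; zero; suc; toℕ; fromℕ; fromℕ<; inject₁; punchIn; punchOut)
import Data.Fin.Properties as Fin
open import Data.Fin.Subset using (Subset) renaming (_∈_ to _∈ₛ_; _∉_ to _∉ₛ_)
open import Data.Vec using (lookup; tabulate)
open import Data.Vec.Properties using (lookup∘tabulate; []=⇒lookup; lookup⇒[]=)
open import Data.Maybe using (Maybe; just; nothing)
open import Data.Maybe.Relation.Unary.All as Maybe using (just; nothing)
open import Data.Product using (Σ; Σ-syntax; ∃; ∃₂; _×_; _,_; proj₁; proj₂)
open import Data.Sum using (_⊎_; inj₁; inj₂)
open import Data.List using (List; []; _∷_; length; filter; map; upTo; allFin)
open import Data.List.Properties using (filter-notAll; length-map; length-upTo; length-tabulate)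
open import Data.List.Membership.Propositional using (_∈_)
open import Data.List.Membership.Propositional.Properties
  using (∈-filter⁺; ∈-filter⁻; ∈-map⁻; ∈-upTo⁺; ∈-allFin)
open import Data.List.Relation.Binary.Subset.Propositional using (_⊆_)
open import Data.List.Relation.Unary.Any using (here; there)
import Data.List.Relation.Unary.Any as Any
import Data.List.Relation.Unary.All as All
open import Data.List.Relation.Unary.AllPairs using ([]; _∷_)
open import Data.List.Relation.Unary.Unique.Propositional using (Unique)
import Data.List.Relation.Unary.Unique.Propositional.Properties as Unique
open import Function using (_∘_)
open import Function.Bundles using (_⇔_; mk⇔; Equivalence)
open import Relation.Binary.PropositionalEquality
open import Relation.Binary.Definitions using (DecidableEquality; tri<; tri≈; tri>)
open import Relation.Nullary
  using (¬_; Dec; yes; no; does; ¬?; contradiction; decidable-stable; _×-dec_; _⊎-dec_)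
import Relation.Nullary.Decidable as Dec
open import Relation.Unary using (Pred; Decidable)
open import Relation.Unary.Properties using (∁?)

-- Binomial coefficients C(m,2) and the colex ranking of pairs

[1+m]C2≡m+mC2 : ∀ m → suc m C 2 ≡ m + m C 2
[1+m]C2≡m+mC2 m = trans (sym (nCk+nC[k+1]≡[n+1]C[k+1] m 1)) (cong (_+ m C 2) (nC1≡n m))

C2-mono-≤ : ∀ {m n} → m ≤ n → m C 2 ≤ n C 2
C2-mono-≤ m≤n = go (≤⇒≤′ m≤n)
  where
  go : ∀ {m n} → m ≤′ n → m C 2 ≤ n C 2
  go ≤′-refl = ≤-refl
  go {n = suc n} (≤′-step m≤′n) =
    ≤-trans (go m≤′n) (≤-trans (m≤n+m (n C 2) n) (≤-reflexive (sym ([1+m]C2≡m+mC2 n))))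

C2-cancel-< : ∀ {m n} → m C 2 < n C 2 → m < n
C2-cancel-< mC2<nC2 = ≰⇒> λ n≤m → <⇒≱ mC2<nC2 (C2-mono-≤ n≤m)

2m≤mC2 : ∀ {m} → 5 ≤ m → 2 * m ≤ m C 2
2m≤mC2 5≤m = go (≤⇒≤′ 5≤m)
  where
  go : ∀ {m} → 5 ≤′ m → 2 * m ≤ m C 2
  go ≤′-refl = ≤-refl
  go {suc m} (≤′-step 5≤′m) = begin
    2 * suc m   ≡⟨ *-suc 2 m ⟩
    2 + 2 * m   ≤⟨ +-mono-≤ (≤-trans (s≤s (s≤s z≤n)) (≤′⇒≤ 5≤′m)) (go 5≤′m) ⟩
    m + m C 2   ≡⟨ [1+m]C2≡m+mC2 m ⟨
    suc m C 2   ∎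
    where open ≤-Reasoning

mC2≤2m : ∀ {m} → m ≤ 5 → m C 2 ≤ 2 * m
mC2≤2m {0} _ = z≤n
mC2≤2m {1} _ = z≤n
mC2≤2m {2} _ = ≤ᵇ⇒≤ 1 4 _
mC2≤2m {3} _ = ≤ᵇ⇒≤ 3 6 _
mC2≤2m {4} _ = ≤ᵇ⇒≤ 6 8 _
mC2≤2m {5} _ = ≤-refl
mC2≤2m {suc (suc (suc (suc (suc (suc _)))))} (s≤s (s≤s (s≤s (s≤s (s≤s ())))))

capacity : ℕ → ℕ
capacity m = 2 * m ⊔ m C 2

2+capacity≤capacity-suc : ∀ m → 2 + capacity m ≤ capacity (suc m)
2+capacity≤capacity-suc m = begin
  2 + (2 * m ⊔ m C 2)        ≡⟨ +-distribˡ-⊔ 2 (2 * m) (m C 2) ⟩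
  (2 + 2 * m) ⊔ (2 + m C 2)  ≡⟨ cong (_⊔ (2 + m C 2)) (*-suc 2 m) ⟨
  2 * suc m ⊔ (2 + m C 2)    ≤⟨ ⊔-lub (m≤m⊔n (2 * suc m) (suc m C 2)) (2+C2≤ m) ⟩
  2 * suc m ⊔ suc m C 2      ∎
  where
  open ≤-Reasoning
  2+C2≤ : ∀ m → 2 + m C 2 ≤ capacity (suc m)
  2+C2≤ 0 = s≤s (s≤s z≤n)
  2+C2≤ 1 = s≤s (s≤s z≤n)
  2+C2≤ m@(suc (suc _)) =
    ≤-trans (+-monoˡ-≤ (m C 2) (s≤s (s≤s z≤n)))
            (≤-trans (≤-reflexive (sym ([1+m]C2≡m+mC2 m))) (m≤n⊔m _ _))

m<⌈n/2⌉⇒2m<n : ∀ {m n} → m < ⌈ n /2⌉ → 2 * m < n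
m<⌈n/2⌉⇒2m<n {m} {n} m<⌈n/2⌉ = ≰⇒> λ n≤2m → <⇒≱ m<⌈n/2⌉ (begin
  ⌈ n /2⌉       ≤⟨ ⌈n/2⌉-mono n≤2m ⟩
  ⌈ 2 * m /2⌉   ≡⟨ cong ⌈_/2⌉ (cong (m +_) (+-identityʳ m)) ⟩
  ⌈ m + m /2⌉   ≡⟨ n≡⌈n+n/2⌉ m ⟨
  m             ∎)
  where open ≤-Reasoning

n≤2⌈n/2⌉ : ∀ n → n ≤ 2 * ⌈ n /2⌉
n≤2⌈n/2⌉ n = begin
  n                   ≡⟨ ⌊n/2⌋+⌈n/2⌉≡n n ⟨
  ⌊ n /2⌋ + ⌈ n /2⌉   ≤⟨ +-monoˡ-≤ ⌈ n /2⌉ (⌊n/2⌋≤⌈n/2⌉ n) ⟩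
  ⌈ n /2⌉ + ⌈ n /2⌉   ≡⟨ cong (⌈ n /2⌉ +_) (+-identityʳ ⌈ n /2⌉) ⟨
  2 * ⌈ n /2⌉         ∎
  where open ≤-Reasoning

-- The rank of the pair c < d in colex order.
pairIndex : ℕ → ℕ → ℕ
pairIndex c d = d C 2 + c

pairIndex<C2 : ∀ {c d t} → c < d → d < t → pairIndex c d < t C 2
pairIndex<C2 {c} {d} c<d d<t = begin-strict
  d C 2 + c   <⟨ +-monoʳ-< (d C 2) c<d ⟩
  d C 2 + d   ≡⟨ trans (+-comm (d C 2) d) (sym ([1+m]C2≡m+mC2 d)) ⟩
  suc d C 2   ≤⟨ C2-mono-≤ d<t ⟩
  _           ∎
  where open ≤-Reasoning

pairIndex<C2⇒< : ∀ {c d t} → pairIndex c d < t C 2 → d < t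
pairIndex<C2⇒< {c} {d} lt = C2-cancel-< (≤-<-trans (m≤m+n (d C 2) c) lt)

pairIndex-injective : ∀ {c d c′ d′} → c < d → c′ < d′ →
                      pairIndex c d ≡ pairIndex c′ d′ → c ≡ c′ × d ≡ d′
pairIndex-injective {c} {d} {c′} {d′} c<d c′<d′ eq with <-cmp d d′
... | tri≈ _ refl _ = +-cancelˡ-≡ (d C 2) c c′ eq , refl
... | tri< d<d′ _ _ = contradiction eq (<⇒≢ (<-≤-trans (pairIndex<C2 c<d d<d′) (m≤m+n _ c′)))
... | tri> _ _ d′<d = contradiction (sym eq) (<⇒≢ (<-≤-trans (pairIndex<C2 c′<d′ d′<d) (m≤m+n _ c)))

pairIndex-surjective : ∀ r → ∃₂ λ c d → c < d × pairIndex c d ≡ r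
pairIndex-surjective zero = 0 , 1 , z<s , refl
pairIndex-surjective (suc r) with pairIndex-surjective r
... | c , d , c<d , refl with suc c <? d
...   | yes 1+c<d = suc c , d , 1+c<d , +-suc (d C 2) c
...   | no  1+c≮d = 0 , suc d , z<s , (begin
  suc d C 2 + 0     ≡⟨ +-identityʳ _ ⟩
  suc d C 2         ≡⟨ [1+m]C2≡m+mC2 d ⟩
  d + d C 2         ≡⟨ cong (_+ d C 2) (≤-antisym c<d (≮⇒≥ 1+c≮d)) ⟨
  suc c + d C 2     ≡⟨ cong suc (+-comm c (d C 2)) ⟩
  suc (d C 2 + c)   ∎)
  where open ≡-Reasoning

xor-cancelʳ : ∀ a e → (a xor e) xor e ≡ a
xor-cancelʳ a e =
  trans (Bool.xor-assoc a e e) (trans (cong (a xor_) (Bool.xor-same e)) (Bool.xor-identityʳ a))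

xor-≡⇔ : ∀ {s e γ} → s xor e ≡ γ ⇔ s ≡ γ xor e
xor-≡⇔ {s} {e} {γ} = mk⇔ (λ eq → trans (sym (xor-cancelʳ s e)) (cong (_xor e) eq))
                         (λ eq → trans (cong (_xor e) eq) (xor-cancelʳ γ e))

xor-≢⇒≡ : ∀ {s t d} → s xor t ≢ d → t ≡ s xor not d
xor-≢⇒≡ {s} {t} {d} s⊕t≢d = begin
  t                ≡⟨ xor-cancelʳ t s ⟨
  (t xor s) xor s  ≡⟨ cong (_xor s) (Bool.xor-comm t s) ⟩
  (s xor t) xor s  ≡⟨ cong (_xor s) (Bool.¬-not s⊕t≢d) ⟩
  not d xor s      ≡⟨ Bool.xor-comm (not d) s ⟩
  s xor not d      ∎
  where open ≡-Reasoning

xor-≡-cases : ∀ s t x y → s xor t ≡ x xor y → (s ≡ x × t ≡ y) ⊎ (s ≡ not x × t ≡ not y)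
xor-≡-cases false false false y eq = inj₁ (refl , eq)
xor-≡-cases false false true  y eq = inj₂ (refl , eq)
xor-≡-cases false true  false y eq = inj₁ (refl , eq)
xor-≡-cases false true  true  y eq = inj₂ (refl , eq)
xor-≡-cases true  false false y eq = inj₂ (refl , cong not eq)
xor-≡-cases true  false true  y eq = inj₁ (refl , trans (cong not eq) (Bool.not-involutive y))
xor-≡-cases true  true  false y eq = inj₂ (refl , cong not eq)
xor-≡-cases true  true  true  y eq = inj₁ (refl , trans (cong not eq) (Bool.not-involutive y))

length-filter+filter-∁ : ∀ {A : Set} {P : Pred A 0ℓ} (P? : Decidable P) xs →
                         length (filter P? xs) + length (filter (∁? P?) xs) ≡ length xs
length-filter+filter-∁ P? [] = refl
length-filter+filter-∁ P? (x ∷ xs) with P? x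
... | yes _ = cong suc (length-filter+filter-∁ P? xs)
... | no  _ = trans (+-suc _ _) (cong suc (length-filter+filter-∁ P? xs))

length≤2+filter-∁ : ∀ {A : Set} {P : Pred A 0ℓ} (P? : Decidable P) xs → length (filter P? xs) ≤ 2 →
                    length xs ≤ 2 + length (filter (∁? P?) xs)
length≤2+filter-∁ P? xs ≤2 = begin
  length xs                                            ≡⟨ length-filter+filter-∁ P? xs ⟨
  length (filter P? xs) + length (filter (∁? P?) xs)   ≤⟨ +-monoˡ-≤ _ ≤2 ⟩
  2 + length (filter (∁? P?) xs)                       ∎
  where open ≤-Reasoning

module _ {A : Set} (_≟_ : DecidableEquality A) where

  length-mono-⊆ : ∀ {xs ys : List A} → Unique xs → xs ⊆ ys → length xs ≤ length ys
  length-mono-⊆ {[]} _ _ = z≤n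
  length-mono-⊆ {x ∷ xs} {ys} (x∉xs ∷ xs!) x∷xs⊆ys = begin-strict
    length xs                    ≤⟨ length-mono-⊆ xs! xs⊆ys∖x ⟩
    length (filter (x ≢?_) ys)   <⟨ filter-notAll (x ≢?_) ys x∈ys ⟩
    length ys                    ∎
    where
    open ≤-Reasoning
    _≢?_ : ∀ a b → Dec (a ≢ b)
    a ≢? b = ¬? (a ≟ b)
    xs⊆ys∖x : xs ⊆ filter (x ≢?_) ys
    xs⊆ys∖x u∈xs = ∈-filter⁺ (x ≢?_) (x∷xs⊆ys (there u∈xs)) (All.lookup x∉xs u∈xs)
    x∈ys : Any.Any (λ y → ¬ x ≢ y) ys
    x∈ys = Any.map (λ x≡y x≢y → x≢y x≡y) (x∷xs⊆ys (here refl))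

module _ {A B : Set} (_≟_ : DecidableEquality B) (f : A → B) where

  unique-map⊎collision : ∀ {xs} → Unique xs →
    Unique (map f xs) ⊎ ∃₂ λ v w → v ∈ xs × w ∈ xs × v ≢ w × f v ≡ f w
  unique-map⊎collision {[]} [] = inj₁ []
  unique-map⊎collision {x ∷ xs} (x∉xs ∷ xs!) with unique-map⊎collision xs!
  ... | inj₂ (v , w , v∈ , w∈ , v≢w , fv≡fw) = inj₂ (v , w , there v∈ , there w∈ , v≢w , fv≡fw)
  ... | inj₁ fxs! with Any.any? (f x ≟_) (map f xs)
  ...   | no fx∉ = inj₁ (All.tabulate (λ y∈ fx≡y → fx∉ (subst (_∈ map f xs) (sym fx≡y) y∈)) ∷ fxs!)
  ...   | yes fx∈ with ∈-map⁻ f fx∈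
  ...     | w , w∈ , fx≡fw = inj₂ (x , w , here refl , there w∈ , All.lookup x∉xs w∈ , fx≡fw)

-- Keys: pairs of literals singling out a row of a Boolean matrix

Literal : ℕ → Set
Literal m = Fin m × Bool

Key : ℕ → Set
Key m = Literal m × Literal m

columnIndex : ∀ {m} → Key m → ℕ
columnIndex ((a , _) , (b , _)) = pairIndex (toℕ a) (toℕ b)

sortKey : ∀ {m} → Key m → Key m
sortKey (ℓ₁ , ℓ₂) with toℕ (proj₁ ℓ₁) ℕ.≤? toℕ (proj₁ ℓ₂)
... | yes _ = ℓ₁ , ℓ₂
... | no  _ = ℓ₂ , ℓ₁

sortKey-sorted : ∀ {m} (κ : Key m) → toℕ (proj₁ (proj₁ (sortKey κ))) ≤ toℕ (proj₁ (proj₂ (sortKey κ)))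
sortKey-sorted (ℓ₁ , ℓ₂) with toℕ (proj₁ ℓ₁) ℕ.≤? toℕ (proj₁ ℓ₂)
... | yes a≤b = a≤b
... | no  a≰b = <⇒≤ (≰⇒> a≰b)

module _ {R : Set} where

  Satisfies : ∀ {m} → (R → Fin m → Bool) → R → Literal m → Set
  Satisfies M u (c , γ) = M u c ≡ γ

  satisfies? : ∀ {m} (M : R → Fin m → Bool) (ℓ : Literal m) → Decidable (λ u → Satisfies M u ℓ)
  satisfies? M (c , γ) u = M u c Bool.≟ γ

  SatisfiesKey : ∀ {m} → (R → Fin m → Bool) → R → Key m → Set
  SatisfiesKey M u (ℓ₁ , ℓ₂) = Satisfies M u ℓ₁ × Satisfies M u ℓ₂

  Identifies : ∀ {m} → (R → Fin m → Bool) → List R → Key m → R → Set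
  Identifies M rs κ v = SatisfiesKey M v κ × (∀ {u} → u ∈ rs → SatisfiesKey M u κ → u ≡ v)

  record Identifying {m} (M : R → Fin m → Bool) (rs : List R) : Set where
    field
      key        : R → Key m
      identifies : ∀ {v} → v ∈ rs → Identifies M rs (key v) v

  identifies-swap : ∀ {m M rs v} {ℓ₁ ℓ₂ : Literal m} →
                    Identifies M rs (ℓ₁ , ℓ₂) v → Identifies M rs (ℓ₂ , ℓ₁) v
  identifies-swap ((v⊨₁ , v⊨₂) , unique) =
    (v⊨₂ , v⊨₁) , λ u∈ (u⊨₂ , u⊨₁) → unique u∈ (u⊨₁ , u⊨₂)

  identifies-sortKey : ∀ {m M rs v} (κ : Key m) → Identifies M rs κ v → Identifies M rs (sortKey κ) v
  identifies-sortKey {M = M} (ℓ₁ , ℓ₂) idv with toℕ (proj₁ ℓ₁) ℕ.≤? toℕ (proj₁ ℓ₂)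
  ... | yes _ = idv
  ... | no  _ = identifies-swap {M = M} idv

  deleteColumn : ∀ {k} → Fin (suc k) → (R → Fin (suc k) → Bool) → R → Fin k → Bool
  deleteColumn q M u c = M u (punchIn q c)

  -- A literal on the deleted column q is replaced by `replace γ`, where `nothing`
  -- stands for a literal that holds on all of rs′.
  module ColumnDeletion {k} (M : R → Fin (suc (suc k)) → Bool) (q : Fin (suc (suc k)))
    {rs rs′ : List R} (rs′⊆rs : rs′ ⊆ rs) (replace : Bool → Maybe (Literal (suc k)))
    (replace-faithful : ∀ {γ w u} → w ∈ rs′ → M w q ≡ γ → u ∈ rs′ →
                        M u q ≡ γ ⇔ Maybe.All (Satisfies (deleteColumn q M) u) (replace γ))
    where

    M′ : R → Fin (suc k) → Bool
    M′ = deleteColumn q M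

    translate : Literal (suc (suc k)) → Maybe (Literal (suc k))
    translate (c , γ) with q Fin.≟ c
    ... | yes _   = replace γ
    ... | no  q≢c = just (punchOut q≢c , γ)

    translate-faithful : ∀ ℓ {w u} → w ∈ rs′ → Satisfies M w ℓ → u ∈ rs′ →
                         Satisfies M u ℓ ⇔ Maybe.All (Satisfies M′ u) (translate ℓ)
    translate-faithful (c , γ) {u = u} w∈ w⊨ℓ u∈ with q Fin.≟ c
    ... | yes refl = replace-faithful w∈ w⊨ℓ u∈
    ... | no  q≢c  = mk⇔ (λ u⊨ℓ → just (trans (cong (M u) (Fin.punchIn-punchOut q≢c)) u⊨ℓ))
                         (λ { (just u⊨ℓ′) → trans (cong (M u) (sym (Fin.punchIn-punchOut q≢c))) u⊨ℓ′ })

    assemble : Maybe (Literal (suc k)) → Maybe (Literal (suc k)) → Literal (suc k) → Key (suc k)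
    assemble (just ℓ₁) (just ℓ₂) _ = ℓ₁ , ℓ₂
    assemble (just ℓ₁) nothing   _ = ℓ₁ , ℓ₁
    assemble nothing   (just ℓ₂) _ = ℓ₂ , ℓ₂
    assemble nothing   nothing   ℓ = ℓ , ℓ

    assemble-satisfied : ∀ {u} o₁ o₂ ℓ → Maybe.All (Satisfies M′ u) o₁ → Maybe.All (Satisfies M′ u) o₂ →
                         Satisfies M′ u ℓ → SatisfiesKey M′ u (assemble o₁ o₂ ℓ)
    assemble-satisfied (just _) (just _) _ (just u⊨₁) (just u⊨₂) _   = u⊨₁ , u⊨₂
    assemble-satisfied (just _) nothing  _ (just u⊨₁) nothing    _   = u⊨₁ , u⊨₁
    assemble-satisfied nothing  (just _) _ nothing    (just u⊨₂) _   = u⊨₂ , u⊨₂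
    assemble-satisfied nothing  nothing  _ nothing    nothing    u⊨ℓ = u⊨ℓ , u⊨ℓ

    assemble-sound : ∀ {u} o₁ o₂ ℓ → SatisfiesKey M′ u (assemble o₁ o₂ ℓ) →
                     Maybe.All (Satisfies M′ u) o₁ × Maybe.All (Satisfies M′ u) o₂
    assemble-sound (just _) (just _) _ (u⊨₁ , u⊨₂) = just u⊨₁ , just u⊨₂
    assemble-sound (just _) nothing  _ (u⊨₁ , _)   = just u⊨₁ , nothing
    assemble-sound nothing  (just _) _ (u⊨₂ , _)   = nothing , just u⊨₂
    assemble-sound nothing  nothing  _ _           = nothing , nothing

    identifying-deleteColumn : Identifying M rs → Identifying M′ rs′
    identifying-deleteColumn I = record
      { key        = key′
      ; identifies = λ v∈ →
          let ((v⊨₁ , v⊨₂) , unique) = identifies (rs′⊆rs v∈) in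
          assemble-satisfied _ _ _ (to (translate-faithful _ v∈ v⊨₁ v∈) v⊨₁)
                                   (to (translate-faithful _ v∈ v⊨₂ v∈) v⊨₂) refl ,
          λ u∈ u⊨ → let (u⊨₁ , u⊨₂) = assemble-sound _ _ _ u⊨ in
            unique (rs′⊆rs u∈) (from (translate-faithful _ v∈ v⊨₁ u∈) u⊨₁ ,
                                from (translate-faithful _ v∈ v⊨₂ u∈) u⊨₂)
      }
      where
      open Identifying I
      open Equivalence
      key′ : R → Key (suc k)
      key′ v = assemble (translate (proj₁ (key v))) (translate (proj₂ (key v))) (zero , M′ v zero)

  -- The lower bound n ≤ max (2m, C(m,2))

  Thin : ∀ {m} → (R → Fin m → Bool) → List R → Literal m → Set
  Thin M rs ℓ = length (filter (satisfies? M ℓ) rs) ≤ 2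

  thin? : ∀ {m} (M : R → Fin m → Bool) rs → Dec (∃ (Thin M rs))
  thin? M rs = Dec.map′ (λ { (a , inj₁ t) → (a , true) , t ; (a , inj₂ t) → (a , false) , t })
                        (λ { ((a , true) , t) → a , inj₁ t ; ((a , false) , t) → a , inj₂ t })
                        (Fin.any? λ a → thin-at (a , true) ⊎-dec thin-at (a , false))
    where
    thin-at : ∀ ℓ → Dec (Thin M rs ℓ)
    thin-at ℓ = length (filter (satisfies? M ℓ) rs) ≤? 2

  record Reduction {k} (M : R → Fin (suc k) → Bool) (rs : List R) : Set where
    field
      M′          : R → Fin k → Bool
      rows        : List R
      unique      : Unique rows
      identifying : Identifying M′ rows
      length≤2+   : length rs ≤ 2 + length rows

  module LowerBound (_≟_ : DecidableEquality R) where

    ⊆-pair⇒Thin : ∀ {m} {M : R → Fin m → Bool} {rs ℓ v w} → Unique rs →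
                  filter (satisfies? M ℓ) rs ⊆ v ∷ w ∷ [] → Thin M rs ℓ
    ⊆-pair⇒Thin rs! ⊆vw = length-mono-⊆ _≟_ (Unique.filter⁺ _ rs!) ⊆vw

    thin-reduction : ∀ {k} {M : R → Fin (suc (suc k)) → Bool} {rs} → Unique rs → Identifying M rs →
                     ∀ a x → Thin M rs (a , x) → Reduction M rs
    thin-reduction {M = M} {rs} rs! I a x thin = record
      { M′          = deleteColumn a M
      ; rows        = rows
      ; unique      = Unique.filter⁺ _ rs!
      ; identifying = ColumnDeletion.identifying-deleteColumn M a (proj₁ ∘ ∈-filter⁻ _ {xs = rs})
                                                              (λ _ → nothing) constant I
      ; length≤2+   = length≤2+filter-∁ (satisfies? M (a , x)) rs thin
      }
      where
      rows : List R
      rows = filter (∁? (satisfies? M (a , x))) rs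
      column≡not : ∀ {u} → u ∈ rows → M u a ≡ not x
      column≡not u∈ = Bool.¬-not (proj₂ (∈-filter⁻ _ {xs = rs} u∈))
      constant : ∀ {γ w u} → w ∈ rows → M w a ≡ γ → u ∈ rows →
                 M u a ≡ γ ⇔ Maybe.All (Satisfies (deleteColumn a M) u) nothing
      constant w∈ w⊨ u∈ =
        mk⇔ (λ _ → nothing) (λ _ → trans (column≡not u∈) (trans (sym (column≡not w∈)) w⊨))

    twin-reduction : ∀ {k} {M : R → Fin (suc (suc k)) → Bool} {rs v w p q x y} → Unique rs → Identifying M rs →
                     q ≢ p → Identifies M rs ((p , x) , (q , y)) v → Identifies M rs ((p , not x) , (q , not y)) w →
                     Reduction M rs
    twin-reduction {k} {M} {rs} {v} {w} {p} {q} {x} {y} rs! I q≢p (_ , v-unique) (_ , w-unique) = record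
      { M′          = deleteColumn q M
      ; rows        = rows
      ; unique      = Unique.filter⁺ _ rs!
      ; identifying = ColumnDeletion.identifying-deleteColumn M q (proj₁ ∘ ∈-filter⁻ _ {xs = rs})
                                                              replace dependent I
      ; length≤2+   = length≤2+filter-∁ twin? rs (length-mono-⊆ _≟_ (Unique.filter⁺ _ rs!) twins⊆)
      }
      where
      Twin : Pred R 0ℓ
      Twin u = M u p xor M u q ≡ x xor y
      twin? : Decidable Twin
      twin? u = (M u p xor M u q) Bool.≟ (x xor y)
      rows : List R
      rows = filter (∁? twin?) rs
      twins⊆ : filter twin? rs ⊆ v ∷ w ∷ []
      twins⊆ {u} u∈ with ∈-filter⁻ twin? {xs = rs} u∈
      ... | u∈rs , twin with xor-≡-cases (M u p) (M u q) x y twin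
      ...   | inj₁ u⊨v = here (v-unique u∈rs u⊨v)
      ...   | inj₂ u⊨w = there (here (w-unique u∈rs u⊨w))
      replace : Bool → Maybe (Literal (suc k))
      replace γ = just (punchOut q≢p , γ xor not (x xor y))
      dependent : ∀ {γ w u} → w ∈ rows → M w q ≡ γ → u ∈ rows →
                  M u q ≡ γ ⇔ Maybe.All (Satisfies (deleteColumn q M) u) (replace γ)
      dependent {γ} {_} {u} _ _ u∈ =
        mk⇔ (λ u⊨ → just (trans p-column (Equivalence.to xor-≡⇔ (trans (sym q-column) u⊨))))
            (λ { (just u⊨) → trans q-column (Equivalence.from xor-≡⇔ (trans (sym p-column) u⊨)) })
        where
        q-column : M u q ≡ M u p xor not (x xor y)
        q-column = xor-≢⇒≡ {M u p} (proj₂ (∈-filter⁻ (∁? twin?) {xs = rs} u∈))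
        p-column : deleteColumn q M u (punchOut q≢p) ≡ M u p
        p-column = cong (M u) (Fin.punchIn-punchOut q≢p)

    module Thick {m} {M : R → Fin m → Bool} {rs} (rs! : Unique rs) (thick : ∀ ℓ → ¬ Thin M rs ℓ) where

      distinct-columns : ∀ {v a x b y} → Identifies M rs ((a , x) , (b , y)) v → a ≢ b
      distinct-columns {v} {a} {x} ((v⊨x , v⊨y) , v-unique) refl =
        thick (a , x) (⊆-pair⇒Thin {M = M} {v = v} {w = v} rs! λ u∈ →
          let (u∈rs , u⊨x) = ∈-filter⁻ (satisfies? M (a , x)) {xs = rs} u∈ in
          here (v-unique u∈rs (u⊨x , trans u⊨x (trans (sym v⊨x) v⊨y))))

      shared-literal-⊆ : ∀ {v w ℓ q y y′} → v ≢ w → w ∈ rs →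
                         Identifies M rs (ℓ , (q , y)) v → Identifies M rs (ℓ , (q , y′)) w →
                         filter (satisfies? M ℓ) rs ⊆ v ∷ w ∷ []
      shared-literal-⊆ {ℓ = ℓ} {q} {y} {y′} v≢w w∈ (_ , v-unique) ((w⊨ℓ , w⊨y′) , w-unique) {u} u∈
        with ∈-filter⁻ (satisfies? M ℓ) {xs = rs} u∈ | M u q Bool.≟ y
      ... | u∈rs , u⊨ℓ | yes u⊨y = here (v-unique u∈rs (u⊨ℓ , u⊨y))
      ... | u∈rs , u⊨ℓ | no  u⊭y =
        there (here (w-unique u∈rs (u⊨ℓ , trans (Bool.¬-not u⊭y) (sym (Bool.¬-not y′≢y)))))
        where
        y′≢y : y′ ≢ y
        y′≢y y′≡y = v≢w (sym (v-unique w∈ (w⊨ℓ , trans w⊨y′ y′≡y)))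

      twins-complementary : ∀ {v w p q x y x′ y′} → v ≢ w → w ∈ rs →
                            Identifies M rs ((p , x) , (q , y)) v → Identifies M rs ((p , x′) , (q , y′)) w →
                            x′ ≡ not x × y′ ≡ not y
      twins-complementary {x = x} {y} {x′} {y′} v≢w w∈ idv idw = Bool.¬-not x′≢x , Bool.¬-not y′≢y
        where
        x′≢x : x′ ≢ x
        x′≢x refl = thick _ (⊆-pair⇒Thin {M = M} rs! (shared-literal-⊆ v≢w w∈ idv idw))
        y′≢y : y′ ≢ y
        y′≢y refl = thick _ (⊆-pair⇒Thin {M = M} rs!
          (shared-literal-⊆ v≢w w∈ (identifies-swap {M = M} idv) (identifies-swap {M = M} idw)))

    module ThickBound {k} {M : R → Fin (suc (suc k)) → Bool} {rs} (rs! : Unique rs) (I : Identifying M rs)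
                      (thick : ∀ ℓ → ¬ Thin M rs ℓ) where
      open Identifying I
      open Thick rs! thick

      m : ℕ
      m = suc (suc k)

      sortedKey : R → Key m
      sortedKey v = sortKey (key v)

      sorted-identifies : ∀ {v} → v ∈ rs → Identifies M rs (sortedKey v) v
      sorted-identifies v∈ = identifies-sortKey {M = M} _ (identifies v∈)

      sorted : ∀ {v} → v ∈ rs → toℕ (proj₁ (proj₁ (sortedKey v))) < toℕ (proj₁ (proj₂ (sortedKey v)))
      sorted {v} v∈ =
        ≤∧≢⇒< (sortKey-sorted (key v)) (distinct-columns (sorted-identifies v∈) ∘ Fin.toℕ-injective)

      code : R → ℕ
      code v = columnIndex (sortedKey v)

      codes⊆ : map code rs ⊆ upTo (m C 2)
      codes⊆ c∈ with ∈-map⁻ code c∈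
      ... | v , v∈ , refl = ∈-upTo⁺ (pairIndex<C2 (sorted v∈) (Fin.toℕ<n _))

      collision : ∀ {v w} (κ κ′ : Key m) → v ≢ w → w ∈ rs →
                  Identifies M rs κ v → Identifies M rs κ′ w →
                  toℕ (proj₁ (proj₁ κ)) < toℕ (proj₁ (proj₂ κ)) → toℕ (proj₁ (proj₁ κ′)) < toℕ (proj₁ (proj₂ κ′)) →
                  columnIndex κ ≡ columnIndex κ′ → Reduction M rs
      collision ((p , x) , (q , y)) ((p′ , x′) , (q′ , y′)) v≢w w∈ idv idw p<q p′<q′ eq
        with pairIndex-injective p<q p′<q′ eq
      ... | p≡p′ , q≡q′ with Fin.toℕ-injective p≡p′ | Fin.toℕ-injective q≡q′
      ... | refl | refl with twins-complementary v≢w w∈ idv idw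
      ... | refl , refl = twin-reduction rs! I (λ q≡p → <⇒≢ p<q (cong toℕ (sym q≡p))) idv idw

      thick-bound : length rs ≤ m C 2 ⊎ Reduction M rs
      thick-bound with unique-map⊎collision ℕ._≟_ code rs!
      ... | inj₁ codes! = inj₁ (begin
        length rs              ≡⟨ length-map code rs ⟨
        length (map code rs)   ≤⟨ length-mono-⊆ ℕ._≟_ codes! codes⊆ ⟩
        length (upTo (m C 2))  ≡⟨ length-upTo (m C 2) ⟩
        m C 2                  ∎)
        where open ≤-Reasoning
      ... | inj₂ (v , w , v∈ , w∈ , v≢w , code≡) =
        inj₂ (collision (sortedKey v) (sortedKey w) v≢w w∈ (sorted-identifies v∈) (sorted-identifies w∈)
                        (sorted v∈) (sorted w∈) code≡)

    single-column-bound : ∀ {M : R → Fin 1 → Bool} {rs} → Unique rs → Identifying M rs → length rs ≤ 2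
    single-column-bound {M} {rs} rs! I with unique-map⊎collision Bool._≟_ (λ u → M u zero) rs!
    ... | inj₁ column! =
      ≤-trans (≤-reflexive (sym (length-map _ rs))) (length-mono-⊆ Bool._≟_ column! λ {b} _ → ∈-Bool b)
      where
      ∈-Bool : ∀ b → b ∈ true ∷ false ∷ []
      ∈-Bool true  = here refl
      ∈-Bool false = there (here refl)
    ... | inj₂ (v , w , v∈ , w∈ , v≢w , v≡w) =
      let (v⊨ , v-unique) = Identifying.identifies I v∈ in
      contradiction (sym (v-unique w∈ (same-column (Identifying.key I v) v⊨ (sym v≡w)))) v≢w
      where
      same-column : ∀ (κ : Key 1) {v w} → SatisfiesKey M v κ → M w zero ≡ M v zero → SatisfiesKey M w κ
      same-column ((zero , _) , (zero , _)) (v⊨₁ , v⊨₂) w≡v = trans w≡v v⊨₁ , trans w≡v v⊨₂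

    SizeBound : ℕ → Set
    SizeBound m = ∀ {M : R → Fin m → Bool} {rs} → Unique rs → Identifying M rs → length rs ≤ capacity m

    reduction-bound : ∀ {k} {M : R → Fin (suc (suc k)) → Bool} {rs} → SizeBound (suc k) →
                      Reduction M rs → length rs ≤ capacity (suc (suc k))
    reduction-bound {k} bound red =
      ≤-trans length≤2+ (≤-trans (+-monoʳ-≤ 2 (bound unique identifying)) (2+capacity≤capacity-suc (suc k)))
      where open Reduction red

    bound-step : ∀ {k} → SizeBound (suc k) → SizeBound (suc (suc k))
    bound-step {k} bound {M} {rs} rs! I with thin? M rs
    ... | yes ((a , x) , thin) = reduction-bound bound (thin-reduction rs! I a x thin)
    ... | no ¬thin with ThickBound.thick-bound rs! I (λ ℓ thin → ¬thin (ℓ , thin))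
    ...   | inj₁ ≤C2 = ≤-trans ≤C2 (m≤n⊔m _ _)
    ...   | inj₂ red = reduction-bound bound red

    identifying-bound : ∀ m → SizeBound m
    identifying-bound zero {rs = []} _ _ = z≤n
    identifying-bound zero {rs = v ∷ _} _ I with Identifying.key I v
    ... | (() , _) , _
    identifying-bound 1 = single-column-bound
    identifying-bound (suc (suc k)) = bound-step (identifying-bound (suc k))

-- Set systems as incidence matrices

-- The key of the pattern (A₁, A₂; i) of Defs: the element lies in exactly the first i of A₁, A₂.
patternKey : ∀ {m} → Fin 3 → Fin m → Fin m → Key m
patternKey zero             a b = (a , false) , (b , false)
patternKey (suc zero)       a b = (a , true)  , (b , false)
patternKey (suc (suc zero)) a b = (a , true)  , (b , true)

twoSets : ∀ {m} → Fin m → Fin m → Fin 2 → Fin m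
twoSets a b zero       = a
twoSets a b (suc zero) = b

module _ {n m} (F : SetSystem n m) where

  incidence : Fin n → Fin m → Bool
  incidence u a = lookup (member F a) u

  incidence-∈ : ∀ {u a} → incidence u a ≡ true → u ∈ₛ member F a
  incidence-∈ {u} {a} = lookup⇒[]= u (member F a)

  incidence-∉ : ∀ {u a} → incidence u a ≡ false → u ∉ₛ member F a
  incidence-∉ u∉ u∈ = Bool.not-¬ ([]=⇒lookup u∈) u∉

  ∈-incidence : ∀ {u a} → u ∈ₛ member F a → incidence u a ≡ true
  ∈-incidence = []=⇒lookup

  ∉-incidence : ∀ {u a} → u ∉ₛ member F a → incidence u a ≡ false
  ∉-incidence u∉ = Bool.¬-not (u∉ ∘ incidence-∈)

  matches⇒satisfiesKey : ∀ i A {u} → Matches F A i u →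
                         SatisfiesKey incidence u (patternKey i (A zero) (A (suc zero)))
  matches⇒satisfiesKey zero A u-matches =
    ∉-incidence (proj₂ (u-matches zero) (s≤s z≤n)) , ∉-incidence (proj₂ (u-matches (suc zero)) (s≤s z≤n))
  matches⇒satisfiesKey (suc zero) A u-matches =
    ∈-incidence (proj₁ (u-matches zero) (s≤s z≤n)) , ∉-incidence (proj₂ (u-matches (suc zero)) (s≤s (s≤s z≤n)))
  matches⇒satisfiesKey (suc (suc zero)) A u-matches =
    ∈-incidence (proj₁ (u-matches zero) (s≤s z≤n)) , ∈-incidence (proj₁ (u-matches (suc zero)) (s≤s (s≤s z≤n)))

  satisfiesKey⇒matches : ∀ i A {u} → SatisfiesKey incidence u (patternKey i (A zero) (A (suc zero))) →
                         Matches F A i u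
  satisfiesKey⇒matches zero             A (u∉₀ , _)   zero       = (λ ()) , λ _ → incidence-∉ u∉₀
  satisfiesKey⇒matches zero             A (_ , u∉₁)   (suc zero) = (λ ()) , λ _ → incidence-∉ u∉₁
  satisfiesKey⇒matches (suc zero)       A (u∈₀ , _)   zero       = (λ _ → incidence-∈ u∈₀) , λ { (s≤s ()) }
  satisfiesKey⇒matches (suc zero)       A (_ , u∉₁)   (suc zero) = (λ { (s≤s ()) }) , λ _ → incidence-∉ u∉₁
  satisfiesKey⇒matches (suc (suc zero)) A (u∈₀ , _)   zero       = (λ _ → incidence-∈ u∈₀) , λ { (s≤s ()) }
  satisfiesKey⇒matches (suc (suc zero)) A (_ , u∈₁)   (suc zero) = (λ _ → incidence-∈ u∈₁) , λ { (s≤s (s≤s ())) }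

  hyperseparating⇒identifying : Hyperseparating 2 F → Identifying incidence (allFin n)
  hyperseparating⇒identifying H = record
    { key        = λ v → let (A , i , _) = H v in patternKey i (A zero) (A (suc zero))
    ; identifies = λ {v} _ → let (A , i , v-matches , others) = H v in
        matches⇒satisfiesKey i A v-matches ,
        λ {u} _ u⊨ → decidable-stable (u Fin.≟ v) λ u≢v → others u u≢v (satisfiesKey⇒matches i A u⊨)
    }

  patterns⇒hyperseparating : (∀ v → Σ[ i ∈ Fin 3 ] Σ[ a ∈ Fin m ] Σ[ b ∈ Fin m ]
                                      Identifies incidence (allFin n) (patternKey i a b) v) →
                             Hyperseparating 2 F
  patterns⇒hyperseparating P v =
    let (i , a , b , v⊨ , unique) = P v in
    twoSets a b , i , satisfiesKey⇒matches i (twoSets a b) v⊨ ,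
    λ u u≢v u-matches → u≢v (unique (∈-allFin u) (matches⇒satisfiesKey i (twoSets a b) u-matches))

  hyperseparating-bound : Hyperseparating 2 F → n ≤ capacity m
  hyperseparating-bound H = subst (_≤ capacity m) (length-tabulate (λ u → u))
    (LowerBound.identifying-bound Fin._≟_ m (Unique.allFin⁺ n) (hyperseparating⇒identifying H))

-- Constructions

module Relational {n m} {_∋_ : Fin m → Fin n → Set} (_∋?_ : ∀ a u → Dec (a ∋ u)) where

  sets : Fin m → Subset n
  sets a = tabulate (λ u → does (a ∋? u))

  Holds : Literal m → Fin n → Set
  Holds (a , true)  u = a ∋ u
  Holds (a , false) u = ¬ a ∋ u

  HoldsKey : Key m → Fin n → Set
  HoldsKey (ℓ₁ , ℓ₂) u = Holds ℓ₁ u × Holds ℓ₂ u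

  satisfies⇔holds : ∀ {u} ℓ → lookup (sets (proj₁ ℓ)) u ≡ proj₂ ℓ ⇔ Holds ℓ u
  satisfies⇔holds {u} (a , γ) rewrite lookup∘tabulate (λ u → does (a ∋? u)) u with a ∋? u | γ
  ... | yes a∋u | true  = mk⇔ (λ _ → a∋u) (λ _ → refl)
  ... | yes a∋u | false = mk⇔ (λ ()) (λ a∌u → contradiction a∋u a∌u)
  ... | no  a∌u | true  = mk⇔ (λ ()) (λ a∋u → contradiction a∋u a∌u)
  ... | no  a∌u | false = mk⇔ (λ _ → a∌u) (λ _ → refl)

  Separating : Set
  Separating = ∀ {a b} → toℕ a < toℕ b → ∃ λ u → a ∋ u × ¬ b ∋ u

  ∋-transport : ∀ {a b u} → sets a ≡ sets b → a ∋ u → b ∋ u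
  ∋-transport {a} {b} {u} sa≡sb a∋u =
    Equivalence.to (satisfies⇔holds (b , true))
      (trans (cong (λ s → lookup s u) (sym sa≡sb)) (Equivalence.from (satisfies⇔holds (a , true)) a∋u))

  sets-injective : Separating → ∀ {a b} → sets a ≡ sets b → a ≡ b
  sets-injective separating {a} {b} sa≡sb with <-cmp (toℕ a) (toℕ b)
  ... | tri< a<b _ _ =
    let (u , a∋u , b∌u) = separating a<b in contradiction (∋-transport sa≡sb a∋u) b∌u
  ... | tri≈ _ a≡b _ = Fin.toℕ-injective a≡b
  ... | tri> _ _ b<a =
    let (u , b∋u , a∌u) = separating b<a in contradiction (∋-transport (sym sa≡sb) b∋u) a∌u

  system : Separating → SetSystem n m
  system separating = record { member = sets ; distinct = sets-injective separating }

  system-hyperseparating : (separating : Separating) →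
    (∀ v → Σ[ i ∈ Fin 3 ] Σ[ a ∈ Fin m ] Σ[ b ∈ Fin m ]
             HoldsKey (patternKey i a b) v × (∀ u → HoldsKey (patternKey i a b) u → u ≡ v)) →
    Hyperseparating 2 (system separating)
  system-hyperseparating separating P = patterns⇒hyperseparating (system separating) λ v →
    let (i , a , b , v-holds , unique) = P v in
    i , a , b , from-holds (patternKey i a b) v-holds , λ {u} _ u⊨ → unique u (to-holds (patternKey i a b) u⊨)
    where
    open Equivalence
    to-holds : ∀ κ {u} → SatisfiesKey (incidence (system separating)) u κ → HoldsKey κ u
    to-holds (ℓ₁ , ℓ₂) (u⊨₁ , u⊨₂) = to (satisfies⇔holds ℓ₁) u⊨₁ , to (satisfies⇔holds ℓ₂) u⊨₂
    from-holds : ∀ κ {u} → HoldsKey κ u → SatisfiesKey (incidence (system separating)) u κ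
    from-holds (ℓ₁ , ℓ₂) (u⊨₁ , u⊨₂) = from (satisfies⇔holds ℓ₁) u⊨₁ , from (satisfies⇔holds ℓ₂) u⊨₂

-- m = suc k
module HalfArcs (k : ℕ) {n} (n≤2m : n ≤ 2 * suc k) (m≤n : suc k ≤ n) where

  Arc : ℕ → ℕ → Set
  Arc a e = a < e × e ≤ a + suc k

  arc-origin : ∀ {u} → ¬ Arc 0 u → ¬ Arc k u → u < suc k + suc k → u ≡ 0
  arc-origin {zero}  _ _ _ = refl
  arc-origin {suc u} ∉₀ ∉ₖ u<2m = contradiction (z<s , ≤-trans u<k (n≤1+n k)) ∉₀
    where
    u<k : suc u ≤ k
    u<k = ≮⇒≥ λ k<u → ∉ₖ (k<u , s≤s⁻¹ u<2m)

  arc-rising : ∀ {j u} → Arc j u → ¬ Arc (suc j) u → u ≡ suc j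
  arc-rising {j} (j<u , u≤j+m) ∉ = ≤-antisym (≮⇒≥ λ 1+j<u → ∉ (1+j<u , ≤-trans u≤j+m (n≤1+n _))) j<u

  arc-summit : ∀ {u} → Arc 0 u → Arc k u → u ≡ suc k
  arc-summit (_ , u≤m) (k<u , _) = ≤-antisym u≤m k<u

  arc-falling : ∀ {j u} → Arc (suc j) u → ¬ Arc j u → u ≡ suc j + suc k
  arc-falling {j} (1+j<u , u≤1+j+m) ∉ =
    ≤-antisym u≤1+j+m (≰⇒> λ u≤j+m → ∉ (<-trans (n<1+n j) 1+j<u , u≤j+m))

  data Position : ℕ → Set where
    origin  : Position 0
    rising  : (a : Fin k) → Position (suc (toℕ a))
    summit  : Position (suc k)
    falling : (a : Fin k) → Position (suc (toℕ a) + suc k)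

  position : ∀ e → e < suc k + suc k → Position e
  position zero _ = origin
  position (suc e) 1+e<2m with <-cmp (suc e) (suc k)
  ... | tri< 1+e<m _ _ = subst (λ e → Position (suc e)) (Fin.toℕ-fromℕ< e<k) (rising (fromℕ< e<k))
    where
    e<k : e < k
    e<k = s≤s⁻¹ 1+e<m
  ... | tri≈ _ refl _ = summit
  ... | tri> _ _ m<1+e with m≤n⇒∃[o]m+o≡n m<1+e
  ...   | j , refl = subst Position index≡ (falling (fromℕ< j<k))
    where
    j<k : j < k
    j<k = +-cancelˡ-< k j k (s≤s⁻¹ (≤-trans (s≤s⁻¹ 1+e<2m) (≤-reflexive (+-suc k k))))
    index≡ : suc (toℕ (fromℕ< j<k)) + suc k ≡ suc (suc k) + j
    index≡ = begin
      suc (toℕ (fromℕ< j<k)) + suc k  ≡⟨ cong (λ i → suc i + suc k) (Fin.toℕ-fromℕ< j<k) ⟩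
      suc j + suc k                   ≡⟨ cong suc (+-suc j k) ⟩
      suc (suc (j + k))               ≡⟨ cong (2 +_) (+-comm j k) ⟩
      suc (suc k) + j                 ∎
      where open ≡-Reasoning

  arc-suc : ∀ j → Arc j (suc j)
  arc-suc j = ≤-refl , ≤-trans (s≤s (m≤m+n j k)) (≤-reflexive (sym (+-suc j k)))

  _∋_ : Fin (suc k) → Fin n → Set
  a ∋ u = Arc (toℕ a) (toℕ u)

  _∋?_ : ∀ a u → Dec (a ∋ u)
  a ∋? u = (toℕ a <? toℕ u) ×-dec (toℕ u ≤? toℕ a + suc k)

  open Relational _∋?_

  ∋-via : ∀ {a u j e} → toℕ a ≡ j → toℕ u ≡ e → a ∋ u ⇔ Arc j e
  ∋-via refl refl = mk⇔ (λ a∋u → a∋u) (λ arc → arc)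

  open Equivalence using (to; from)

  separating : Separating
  separating {a} {b} a<b = fromℕ< 1+a<n , from (∋-via refl index) (arc-suc (toℕ a)) ,
                           λ b∋ → <⇒≱ a<b (s≤s⁻¹ (proj₁ (to (∋-via refl index) b∋)))
    where
    1+a<n : suc (toℕ a) < n
    1+a<n = <-≤-trans (≤-<-trans a<b (Fin.toℕ<n b)) m≤n
    index : toℕ (fromℕ< 1+a<n) ≡ suc (toℕ a)
    index = Fin.toℕ-fromℕ< 1+a<n

  top : Fin (suc k)
  top = fromℕ k

  top≡k : toℕ top ≡ k
  top≡k = Fin.toℕ-fromℕ k

  Pattern : Fin n → Set
  Pattern v = Σ[ i ∈ Fin 3 ] Σ[ a ∈ Fin (suc k) ] Σ[ b ∈ Fin (suc k) ]
                HoldsKey (patternKey i a b) v × (∀ u → HoldsKey (patternKey i a b) u → u ≡ v)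

  <2m : ∀ u → toℕ u < suc k + suc k
  <2m u = <-≤-trans (Fin.toℕ<n u) (≤-trans n≤2m (≤-reflexive (cong (suc k +_) (+-identityʳ (suc k)))))

  coincide : ∀ {u v : Fin n} {e} → toℕ u ≡ e → toℕ v ≡ e → u ≡ v
  coincide u≡e v≡e = Fin.toℕ-injective (trans u≡e (sym v≡e))

  pattern-at : ∀ {e} → Position e → ∀ v → toℕ v ≡ e → Pattern v
  pattern-at origin v v≡ =
    zero , zero , top , (∌v , ∌v) ,
    λ u (u∉₀ , u∉top) → coincide (arc-origin u∉₀ (u∉top ∘ from (∋-via top≡k refl)) (<2m u)) v≡
    where
    ∌v : ∀ {a} → ¬ a ∋ v
    ∌v a∋v = contradiction (proj₁ (to (∋-via refl v≡) a∋v)) λ ()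
  pattern-at (rising a) v v≡ =
    suc zero , inject₁ a , suc a ,
    (from (∋-via (Fin.toℕ-inject₁ a) v≡) (arc-suc (toℕ a)) ,
     λ a∋v → <-irrefl refl (proj₁ (to (∋-via refl v≡) a∋v))) ,
    λ u (u∈ , u∉) → coincide (arc-rising (to (∋-via (Fin.toℕ-inject₁ a) refl) u∈) u∉) v≡
  pattern-at summit v v≡ =
    suc (suc zero) , zero , top ,
    (from (∋-via refl v≡) (z<s , ≤-refl) , from (∋-via top≡k v≡) (arc-suc k)) ,
    λ u (u∈₀ , u∈top) → coincide (arc-summit u∈₀ (to (∋-via top≡k refl) u∈top)) v≡
  pattern-at (falling a) v v≡ =
    suc zero , suc a , inject₁ a ,
    (from (∋-via refl v≡) (m<m+n (suc (toℕ a)) z<s , ≤-refl) ,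
     λ a∋v → <-irrefl refl (proj₂ (to (∋-via (Fin.toℕ-inject₁ a) v≡) a∋v))) ,
    λ u (u∈ , u∉) → coincide (arc-falling u∈ (u∉ ∘ from (∋-via (Fin.toℕ-inject₁ a) refl))) v≡

  halfArcs : Σ (SetSystem n (suc k)) (Hyperseparating 2)
  halfArcs = system separating ,
             system-hyperseparating separating λ v → pattern-at (position (toℕ v) (<2m v)) v refl

same-pair : ∀ {c d c′ d′} → c < d → c′ < d′ → c ≡ c′ ⊎ c ≡ d′ → d ≡ c′ ⊎ d ≡ d′ → c ≡ c′ × d ≡ d′
same-pair c<d c′<d′ (inj₁ c≡c′) (inj₂ d≡d′) = c≡c′ , d≡d′
same-pair c<d c′<d′ (inj₁ refl) (inj₁ refl) = contradiction c<d (<-irrefl refl)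
same-pair c<d c′<d′ (inj₂ refl) (inj₂ refl) = contradiction c<d (<-irrefl refl)
same-pair c<d c′<d′ (inj₂ refl) (inj₁ refl) = contradiction (<-trans c<d c′<d′) (<-irrefl refl)

partner : ∀ {t a b} → 3 ≤ t → a < b → b ≤ t → ∃ λ y → 0 < y × y < t × (a ≡ 0 ⊎ a ≡ y) × y ≢ b
partner {a = suc a} _ a<b b≤t = suc a , z<s , <-≤-trans a<b b≤t , inj₂ refl , <⇒≢ a<b
partner {a = zero} {1} 3≤t _ _ = 2 , z<s , 3≤t , inj₁ refl , λ ()
partner {a = zero} {suc (suc b)} 3≤t _ _ = 1 , z<s , <-≤-trans (s≤s (s≤s z≤n)) 3≤t , inj₁ refl , λ ()

module PairSets (t : ℕ) {n} (n≤C2 : n ≤ suc t C 2) (C2<n : t C 2 < n) (3≤t : 3 ≤ t) where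

  lower upper : Fin n → ℕ
  lower u = proj₁ (pairIndex-surjective (toℕ u))
  upper u = proj₁ (proj₂ (pairIndex-surjective (toℕ u)))

  lower<upper : ∀ u → lower u < upper u
  lower<upper u = proj₁ (proj₂ (proj₂ (pairIndex-surjective (toℕ u))))

  pairIndex-lower-upper : ∀ u → pairIndex (lower u) (upper u) ≡ toℕ u
  pairIndex-lower-upper u = proj₂ (proj₂ (proj₂ (pairIndex-surjective (toℕ u))))

  upper≤t : ∀ u → upper u < suc t
  upper≤t u = pairIndex<C2⇒< (subst (_< suc t C 2) (sym (pairIndex-lower-upper u))
                                    (<-≤-trans (Fin.toℕ<n u) n≤C2))

  pair-element : ∀ {c d} → c < d → d < t → ∃ λ u → lower u ≡ c × upper u ≡ d
  pair-element {c} {d} c<d d<t =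
    u , pairIndex-injective (lower<upper u) c<d (trans (pairIndex-lower-upper u) (Fin.toℕ-fromℕ< u<n))
    where
    u<n : pairIndex c d < n
    u<n = <-trans (pairIndex<C2 c<d d<t) C2<n
    u : Fin n
    u = fromℕ< u<n

  _∋_ : Fin (suc t) → Fin n → Set
  a ∋ u = toℕ a ≡ lower u ⊎ toℕ a ≡ upper u

  _∋?_ : ∀ a u → Dec (a ∋ u)
  a ∋? u = (toℕ a ℕ.≟ lower u) ⊎-dec (toℕ a ℕ.≟ upper u)

  open Relational _∋?_

  separating : Separating
  separating {a} {b} a<b with partner 3≤t a<b (s≤s⁻¹ (Fin.toℕ<n b))
  ... | y , 0<y , y<t , a∈0y , y≢b with pair-element 0<y y<t
  ...   | u , lower≡0 , upper≡y = u , a∋u a∈0y , b∌u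
    where
    a∋u : toℕ a ≡ 0 ⊎ toℕ a ≡ y → a ∋ u
    a∋u (inj₁ a≡0) = inj₁ (trans a≡0 (sym lower≡0))
    a∋u (inj₂ a≡y) = inj₂ (trans a≡y (sym upper≡y))
    b∌u : ¬ b ∋ u
    b∌u (inj₁ b≡lower) = contradiction (subst (toℕ a <_) (trans b≡lower lower≡0) a<b) λ ()
    b∌u (inj₂ b≡upper) = y≢b (sym (trans b≡upper upper≡y))

  lowerSet upperSet : Fin n → Fin (suc t)
  lowerSet v = fromℕ< (<-trans (lower<upper v) (upper≤t v))
  upperSet v = fromℕ< (upper≤t v)

  pair-determined : ∀ {v u} → lowerSet v ∋ u → upperSet v ∋ u → u ≡ v
  pair-determined {v} {u} lower∈u upper∈u = Fin.toℕ-injective (begin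
    toℕ u                          ≡⟨ pairIndex-lower-upper u ⟨
    pairIndex (lower u) (upper u)  ≡⟨ cong₂ pairIndex (proj₁ same) (proj₂ same) ⟨
    pairIndex (lower v) (upper v)  ≡⟨ pairIndex-lower-upper v ⟩
    toℕ v                          ∎)
    where
    open ≡-Reasoning
    on-u : ℕ → Set
    on-u c = c ≡ lower u ⊎ c ≡ upper u
    same : lower v ≡ lower u × upper v ≡ upper u
    same = same-pair (lower<upper v) (lower<upper u)
             (subst on-u (Fin.toℕ-fromℕ< _) lower∈u) (subst on-u (Fin.toℕ-fromℕ< _) upper∈u)

  pairSets : Σ (SetSystem n (suc t)) (Hyperseparating 2)
  pairSets = system separating , system-hyperseparating separating λ v →
    suc (suc zero) , lowerSet v , upperSet v ,
    (inj₁ (Fin.toℕ-fromℕ< _) , inj₂ (Fin.toℕ-fromℕ< _)) ,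
    λ u (lower∈u , upper∈u) → pair-determined lower∈u upper∈u

halfArcSystem : ∀ n → 1 ≤ n → Σ (SetSystem n ⌈ n /2⌉) (Hyperseparating 2)
halfArcSystem (suc n) _ = HalfArcs.halfArcs ⌊ n /2⌋ (n≤2⌈n/2⌉ (suc n)) (⌈n/2⌉≤n (suc n))

minimal-size : ∀ {n t} → (∀ m → m < t → capacity m < n) →
               ∀ m (F : SetSystem n m) → Hyperseparating 2 F → t ≤ m
minimal-size below m F H = ≮⇒≥ λ m<t → <⇒≱ (below m m<t) (hyperseparating-bound F H)

theorem3 : (n : ℕ) → 1 ≤ n →
    ((t : ℕ) → 10 ≤ n → IsMinBinom2 n t → IsMinHypSepSize n 2 t) ×
    (n ≤ 10 → IsMinHypSepSize n 2 ⌈ n /2⌉)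
theorem3 n 1≤n = large , small
  where
  large : (t : ℕ) → 10 ≤ n → IsMinBinom2 n t → IsMinHypSepSize n 2 t
  large zero 10≤n (n≤0 , _) = contradiction (≤-trans 10≤n n≤0) λ ()
  large (suc t) 10≤n (n≤C2 , below) =
    PairSets.pairSets t n≤C2 (below t ≤-refl) 3≤t ,
    minimal-size λ m m<1+t → ⊔-lub (2m<n m m<1+t) (below m m<1+t)
    where
    3≤t : 3 ≤ t
    3≤t = ≮⇒≥ λ t<3 → <⇒≱ (≤ᵇ⇒≤ 4 10 _) (≤-trans 10≤n (≤-trans n≤C2 (C2-mono-≤ t<3)))
    2m<n : ∀ m → m < suc t → 2 * m < n
    2m<n m m<1+t with 5 ≤? m
    ... | yes 5≤m = ≤-<-trans (2m≤mC2 5≤m) (below m m<1+t)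
    ... | no  5≰m = <-≤-trans (*-monoʳ-< 2 (≰⇒> 5≰m)) 10≤n
  small : n ≤ 10 → IsMinHypSepSize n 2 ⌈ n /2⌉
  small n≤10 = halfArcSystem n 1≤n , minimal-size below
    where
    below : ∀ m → m < ⌈ n /2⌉ → capacity m < n
    below m m<⌈n/2⌉ = ⊔-lub 2m<n (≤-<-trans (mC2≤2m (<⇒≤ m<5)) 2m<n)
      where
      2m<n : 2 * m < n
      2m<n = m<⌈n/2⌉⇒2m<n m<⌈n/2⌉
      m<5 : m < 5
      m<5 = *-cancelˡ-< 2 m 5 (<-≤-trans 2m<n n≤10)
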